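{- Let $f:\mathbb N\to\mathbb N$ be an unbounded (weakly) increasing function and let $C\subseteq{}^*\mathbb N$ be a cut with $\mathbb N\subseteq C$ such that $x^{{}^*f(x)}\in C$ for every $x\in C$. Then $C$ is closed under addition and multiplication (i.e. $C$ is a semiring).
   Context: ${}^*\mathbb N=\mathbb N^I/\mathcal F$ is an ultrapower of $\mathbb N$ by a countably incomplete ultrafilter, with $\mathbb N\subseteq{}^*\mathbb N$; ${}^*f:{}^*\mathbb N\to{}^*\mathbb N$ denotes the nonstandard extension of $f$. A cut is a subset of ${}^*\mathbb N$ that is downward closed in the natural order. -}

module Defs where

open import Data.Nat using (ℕ; _≤_; _+_; _*_; _^_)
open import Data.Product using (Σ; _×_; ∃)
open import Data.Sum using (_⊎_)
open import Data.Unit using (⊤)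
open import Relation.Nullary using (¬_)

Subset : Set → Set₁
Subset I = I → Set

_⊆_ : {I : Set} → Subset I → Subset I → Set
A ⊆ B = ∀ i → A i → B i

_∩_ : {I : Set} → Subset I → Subset I → Subset I
(A ∩ B) i = A i × B i

∁ : {I : Set} → Subset I → Subset I
∁ A i = ¬ A i

record IsUltrafilter {I : Set} (𝓕 : Subset I → Set) : Set₁ where
  field
    full     : 𝓕 (λ _ → ⊤)
    proper   : ∀ A → 𝓕 A → ¬ (∀ i → ¬ A i)
    upward   : ∀ A B → A ⊆ B → 𝓕 A → 𝓕 B
    meet     : ∀ A B → 𝓕 A → 𝓕 B → 𝓕 (A ∩ B)
    ultra    : ∀ A → 𝓕 A ⊎ 𝓕 (∁ A)

CountablyIncomplete : {I : Set} → (Subset I → Set) → Set₁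
CountablyIncomplete {I} 𝓕 =
  Σ (ℕ → Subset I) λ A → (∀ n → 𝓕 (A n)) × (∀ i → ∃ λ n → ¬ A n i)

-- Elements of *ℕ = ℕ^I / 𝓕 are represented by functions I → ℕ;
-- equality in *ℕ is 𝓕-almost-everywhere equality (not needed below,
-- as all predicates used are stated via the order, which respects it).
module Ultrapower {I : Set} (𝓕 : Subset I → Set) where

  *ℕ : Set
  *ℕ = I → ℕ

  _≤*_ : *ℕ → *ℕ → Set
  x ≤* y = 𝓕 (λ i → x i ≤ y i)

  ι : ℕ → *ℕ
  ι n _ = n

  ext : (ℕ → ℕ) → *ℕ → *ℕ
  ext f x i = f (x i)

  _+*_ : *ℕ → *ℕ → *ℕ
  (x +* y) i = x i + y i

  _**_ : *ℕ → *ℕ → *ℕ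
  (x ** y) i = x i * y i

  _^*_ : *ℕ → *ℕ → *ℕ
  (x ^* y) i = x i ^ y i

  IsCut : (*ℕ → Set) → Set
  IsCut C = ∀ x y → x ≤* y → C y → C x

Unbounded : (ℕ → ℕ) → Set
Unbounded f = ∀ m → ∃ λ n → m ≤ f n

Increasing : (ℕ → ℕ) → Set
Increasing f = ∀ m n → m ≤ n → f m ≤ f n

-- Let w = max(x, y, N) for a standard N beyond which f ≥ 2. An ultrafilter
-- decides which argument realises a pointwise maximum, so w is dominated by x,
-- y or N and lies in C. Since w ≥ 2 and f(w) ≥ 2 pointwise, both x + y and x·y
-- are at most w² ≤ w^f(w), which lies in C by hypothesis.
{-# OPTIONS --safe #-}
module Submission where

open import Defs
open import Data.Nat using (ℕ; _+_; _*_; _^_; _⊔_; _≤_; NonZero; >-nonZero)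
open import Data.Nat.Properties
open import Data.Product using (_×_; _,_; proj₁; proj₂; ∃)
open import Data.Sum using (inj₁; inj₂)
open import Relation.Binary.PropositionalEquality using (cong; sym)

m+m≤m*m : ∀ {m} → 2 ≤ m → m + m ≤ m * m
m+m≤m*m {m} 2≤m = begin
  m + m      ≡⟨ cong (m +_) (sym (+-identityʳ m)) ⟩
  2 * m      ≤⟨ *-monoˡ-≤ m 2≤m ⟩
  m * m      ∎
  where open ≤-Reasoning

m*m≤m^n : ∀ m .{{_ : NonZero m}} {n} → 2 ≤ n → m * m ≤ m ^ n
m*m≤m^n m {n} 2≤n = begin
  m * m      ≡⟨ cong (m *_) (sym (*-identityʳ m)) ⟩
  m ^ 2      ≤⟨ ^-monoʳ-≤ m 2≤n ⟩
  m ^ n      ∎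
  where open ≤-Reasoning

+-and-*-≤-^ : ∀ {a b m n} → 2 ≤ m → 2 ≤ n → a ≤ m → b ≤ m →
              a + b ≤ m ^ n × a * b ≤ m ^ n
+-and-*-≤-^ {m = m} 2≤m 2≤n a≤m b≤m =
    ≤-trans (+-mono-≤ a≤m b≤m) (≤-trans (m+m≤m*m 2≤m) (m*m≤m^n m 2≤n))
  , ≤-trans (*-mono-≤ a≤m b≤m) (m*m≤m^n m 2≤n)
  where
  instance
    m≢0 : NonZero m
    m≢0 = >-nonZero (≤-trans (n≤1+n 1) 2≤m)

eventually-≥ : ∀ {f} → Unbounded f → Increasing f →
               ∀ k → ∃ λ N → k ≤ N × (∀ m → N ≤ m → k ≤ f m)
eventually-≥ unbounded increasing k with unbounded k
... | n , k≤fn = n + k , m≤n+m k n ,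
      λ m n+k≤m → ≤-trans k≤fn (increasing n m (≤-trans (m≤m+n n k) n+k≤m))

_⊔*_ : {I : Set} → (I → ℕ) → (I → ℕ) → I → ℕ
(x ⊔* y) i = x i ⊔ y i

module CutProperties {I : Set} {𝓕 : Subset I → Set} (U : IsUltrafilter 𝓕)
                     {C : Ultrapower.*ℕ 𝓕 → Set} (cut : Ultrapower.IsCut 𝓕 C) where

  open IsUltrafilter U
  open Ultrapower 𝓕

  pointwise⇒≤* : ∀ {x y} → (∀ i → x i ≤ y i) → x ≤* y
  pointwise⇒≤* x≤y = upward _ _ (λ i _ → x≤y i) full

  cut-pointwise : ∀ {x y} → (∀ i → x i ≤ y i) → C y → C x
  cut-pointwise x≤y = cut _ _ (pointwise⇒≤* x≤y)

  cut-⊔* : ∀ {x y} → C x → C y → C (x ⊔* y)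
  cut-⊔* {x} {y} Cx Cy with ultra (λ i → y i ≤ x i)
  ... | inj₁ y≤x = cut _ x (upward _ _ (λ i yᵢ≤xᵢ → ⊔-lub ≤-refl yᵢ≤xᵢ) y≤x) Cx
  ... | inj₂ y≰x = cut _ y (upward _ _ (λ i yᵢ≰xᵢ → ⊔-lub (≰⇒≥ yᵢ≰xᵢ) ≤-refl) y≰x) Cy

proposition5p1 :
    (I : Set) (𝓕 : Subset I → Set) → IsUltrafilter 𝓕 → CountablyIncomplete 𝓕 →
    (f : ℕ → ℕ) → Unbounded f → Increasing f →
    (C : Ultrapower.*ℕ 𝓕 → Set) → Ultrapower.IsCut 𝓕 C →
    (∀ n → C (Ultrapower.ι 𝓕 n)) →
    (∀ x → C x → C (Ultrapower._^*_ 𝓕 x (Ultrapower.ext 𝓕 f x))) →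
    ∀ x y → C x → C y →
      C (Ultrapower._+*_ 𝓕 x y) × C (Ultrapower._**_ 𝓕 x y)
proposition5p1 _ 𝓕 U _ f unbounded increasing C cut standard power x y Cx Cy
  with eventually-≥ unbounded increasing 2
... | N , 2≤N , 2≤f =
    cut-pointwise (λ i → proj₁ (bound i)) (power w Cw)
  , cut-pointwise (λ i → proj₂ (bound i)) (power w Cw)
  where
  open Ultrapower 𝓕
  open CutProperties U cut

  w : *ℕ
  w = (x ⊔* y) ⊔* ι N

  Cw : C w
  Cw = cut-⊔* (cut-⊔* Cx Cy) (standard N)

  bound : ∀ i → x i + y i ≤ w i ^ f (w i) × x i * y i ≤ w i ^ f (w i)
  bound i = +-and-*-≤-^ (≤-trans 2≤N N≤w) (2≤f (w i) N≤w)
                        (≤-trans (m≤m⊔n (x i) (y i)) (m≤m⊔n _ N))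
                        (≤-trans (m≤n⊔m (x i) (y i)) (m≤m⊔n _ N))
    where N≤w = m≤n⊔m (x i ⊔ y i) N
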